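{- Let $V=\{1,\dots,n\}$, let $0<\lambda_1<\cdots<\lambda_k\le n$ be integers with $\lambda_1>1$, $\lambda_{i+1}-\lambda_i\le\lambda_1$ for all $i=1,\dots,k-1$, and $\lambda_1+\lambda_k=n$, and let $\mathcal H=\bigcup_{j=1}^k\binom{V}{\lambda_j}$. Then for every position $x\in\mathbb Z_{\ge0}^V$ and all integers $\mu,\eta$ with $0\le\mu<m(x)$ and $m(x)-\mu+1\le\eta\le y_{\mathcal H}(x)$ there exists a move $x\to x'$ in $NIM_{\mathcal H}$ such that $m(x')=\mu$ and $y_{\mathcal H}(x')=\eta$.
   Context: $\binom{V}{t}$ is the family of $t$-element subsets of $V$. Hypergraph NIM $NIM_{\mathcal H}$: positions are $x\in\mathbb Z_{\ge0}^V$; a move $x\to x'$ chooses $H\in\mathcal H$ and strictly decreases every coordinate $x_i$, $i\in H$ (to nonnegative values), leaving the other coordinates unchanged. The Tetris value $\mathcal T_{\mathcal H}(x)$ is the maximum number of consecutive moves that can be made starting from $x$. With $e$ the all-ones vector, $m(x)=\min_{i\in V}x_i$ and $y_{\mathcal H}(x)=\mathcal T_{\mathcal H}(x-m(x)e)+1$. -}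

module Defs where

open import Data.Nat using (ℕ; zero; suc; _≤_; _<_; _⊓_; _∸_)
open import Data.Fin using (Fin; zero; suc)
open import Data.Fin.Subset using (Subset; _∈_; _∉_; ∣_∣)
open import Data.Product using (Σ; ∃; _×_)
open import Relation.Binary.PropositionalEquality using (_≡_)

Pos : ℕ → Set
Pos n = Fin n → ℕ

Hypergraph : ℕ → Set₁
Hypergraph n = Subset n → Set

UnionOfLevels : (n k : ℕ) → (Fin k → ℕ) → Hypergraph n
UnionOfLevels n k lam H = Σ (Fin k) λ j → ∣ H ∣ ≡ lam j

Move : ∀ {n} → Hypergraph n → Pos n → Pos n → Set
Move {n} 𝓗 x x' =
  Σ (Subset n) λ H → 𝓗 H ×
    ((∀ i → i ∈ H → x' i < x i) × (∀ i → i ∉ H → x' i ≡ x i))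

data Plays {n} (𝓗 : Hypergraph n) : Pos n → ℕ → Set where
  done : ∀ x → Plays 𝓗 x zero
  step : ∀ {x x' t} → Move 𝓗 x x' → Plays 𝓗 x' t → Plays 𝓗 x (suc t)

Tetris : ∀ {n} → Hypergraph n → Pos n → ℕ → Set
Tetris 𝓗 x t = Plays 𝓗 x t × (∀ s → Plays 𝓗 x s → s ≤ t)

-- m(x) = min_{i ∈ V} x_i  (convention: 0 for the empty ground set,
-- which never occurs in the lemma since n ≥ 2 there).
minV : ∀ {n} → Pos n → ℕ
minV {zero} x = 0
minV {suc zero} x = x zero
minV {suc (suc n)} x = x zero ⊓ minV {suc n} (λ i → x (suc i))

shift : ∀ {n} → Pos n → Pos n
shift x i = x i ∸ minV x

Y : ∀ {n} → Hypergraph n → Pos n → ℕ → Set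
Y 𝓗 x y = Σ ℕ λ t → Tetris 𝓗 (shift x) t × y ≡ suc t

module Submission where

-- Write  capacity w t = Σᵢ min(wᵢ, t).  For a hypergraph 𝓗 all of
-- whose edges have at least l vertices and which contains every l-set, the
-- Tetris value is characterised by capacities:  t moves can be made from w
-- iff  l·t ≤ capacity w t  (edges only remove at least l units of capacity per
-- move; conversely an l-set of the largest coordinates can always be played).
-- The union of levels λ₁ < … < λ_k with λ₁ + λ_k = n is such a hypergraph for
-- l = λ₁, and it also contains the complement of every l-set.
--
-- Given x, μ and η = t + 1 we keep an l-set C of coordinates fixed and lower
-- all others (a move along the edge ∁ C): one coordinate j ∉ C drops to μ, the
-- rest are filled greedily so that the shifted position w has capacity exactly
-- l·t at horizon t; some c ∈ C with height ≤ t above μ keeps the capacity at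
-- horizon t + 1 below l·(t + 1).  Then T(w) = t, i.e. y(x') = η.  Enough room
-- for the filling exists in two cases: either some coordinate other than a
-- minimiser p of x is low (take j = p and compare with T(x - m(x)e) ≥ t), or
-- all of them are high (take c = p, and use n ≥ l + 2).

open import Defs
open import Data.Nat using (ℕ; zero; suc; _≤_; _<_; _+_; _∸_; _*_; _⊓_; z≤n; s≤s; _≤?_)
open import Data.Nat.Properties
open import Data.Bool using (if_then_else_)
open import Data.Fin using (Fin; zero; suc; fromℕ; inject₁; punchIn) renaming (_≟_ to _≟ᶠ_)
open import Data.Fin renaming (_<_ to _<ᶠ_) using ()
open import Data.Fin.Properties using (any?; punchInᵢ≢i)
open import Data.Fin.Subset using (Subset; _∈_; _∉_; _⊆_; ∣_∣; ⁅_⁆; ∁; ⊥; inside; outside)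
open import Data.Fin.Subset.Properties
  using (_∈?_; drop-∷-⊆; s⊆s; out⊆; ⊆-min; p⊆q⇒∣p∣≤∣q∣; ∣⊥∣≡0; ∣⁅x⁆∣≡1; ∣∁p∣≡n∸∣p∣;
         x∈⁅x⁆; x∈⁅y⁆⇒x≡y; x≢y⇒x∉⁅y⁆; x∉⁅y⁆⇒x≢y; x∈∁p⇒x∉p; x∉p⇒x∈∁p; x∉∁p⇒x∈p)
open import Data.Vec using ([]; _∷_; here; tabulate)
open import Data.Vec.Properties using (lookup∘tabulate; []=⇒lookup; lookup⇒[]=)
open import Data.Product using (Σ; ∃; _×_; _,_; proj₁; proj₂)
open import Data.Sum using (_⊎_; inj₁; inj₂)
open import Function using (_∘_; id; case_of_)
open import Relation.Nullary using (Dec; yes; no; does; ¬_; ¬?; contradiction)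
open import Relation.Nullary.Decidable using (dec-true; dec-false; _×-dec_)
open import Relation.Binary.PropositionalEquality
  using (_≡_; _≢_; refl; sym; trans; cong; cong₂; subst; _≗_; module ≡-Reasoning)
open import Algebra.Properties.Semiring.Sum +-*-semiring using (sum; sum-cong-≗; ∑-distrib-+)

sum-mono : ∀ {n} {f g : Fin n → ℕ} → (∀ i → f i ≤ g i) → sum f ≤ sum g
sum-mono {zero}  f≤g = z≤n
sum-mono {suc n} f≤g = +-mono-≤ (f≤g zero) (sum-mono (f≤g ∘ suc))

sum-mono-< : ∀ {n} {f g : Fin n → ℕ} → (∀ i → f i ≤ g i) → (c : Fin n) → f c < g c →
             sum f < sum g
sum-mono-< f≤g zero    fc<gc = +-mono-<-≤ fc<gc (sum-mono (f≤g ∘ suc))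
sum-mono-< f≤g (suc c) fc<gc = +-mono-≤-< (f≤g zero) (sum-mono-< (f≤g ∘ suc) c fc<gc)

sum-const : ∀ n t → sum {n} (λ _ → t) ≡ n * t
sum-const zero    t = refl
sum-const (suc n) t = cong (t +_) (sum-const n t)

weight : ∀ {n} → ℕ → Subset n → Fin n → ℕ
weight t S i = if does (i ∈? S) then t else 0

sum-weight : ∀ {n} t (S : Subset n) → sum (weight t S) ≡ t * ∣ S ∣
sum-weight t []            = sym (*-zeroʳ t)
sum-weight t (inside ∷ S)  = trans (cong (t +_) (sum-weight t S)) (sym (*-suc t ∣ S ∣))
sum-weight t (outside ∷ S) = sum-weight t S

sum-indicator : ∀ {n} (S : Subset n) → sum (weight 1 S) ≡ ∣ S ∣
sum-indicator S = trans (sum-weight 1 S) (*-identityˡ ∣ S ∣)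

sum-point-mass : ∀ {n} t (q : Fin n) → sum (weight t ⁅ q ⁆) ≡ t
sum-point-mass t q = trans (sum-weight t ⁅ q ⁆) (trans (cong (t *_) (∣⁅x⁆∣≡1 q)) (*-identityʳ t))

if-yes : ∀ {P : Set} (P? : Dec P) {a b : ℕ} → P → (if does P? then a else b) ≡ a
if-yes P? {a} {b} p = cong (if_then a else b) (dec-true P? p)

if-no : ∀ {P : Set} (P? : Dec P) {a b : ℕ} → ¬ P → (if does P? then a else b) ≡ b
if-no P? {a} {b} ¬p = cong (if_then a else b) (dec-false P? ¬p)

⟦_⟧ : ∀ {n} {P : Fin n → Set} → (∀ i → Dec (P i)) → Subset n
⟦ P? ⟧ = tabulate (λ i → does (P? i))

∈⟦⟧⁺ : ∀ {n} {P : Fin n → Set} (P? : ∀ i → Dec (P i)) {i} → P i → i ∈ ⟦ P? ⟧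
∈⟦⟧⁺ P? {i} Pi = lookup⇒[]= i _ (trans (lookup∘tabulate _ i) (dec-true (P? i) Pi))

∈⟦⟧⁻ : ∀ {n} {P : Fin n → Set} (P? : ∀ i → Dec (P i)) {i} → i ∈ ⟦ P? ⟧ → P i
∈⟦⟧⁻ P? {i} i∈ with P? i | trans (sym (lookup∘tabulate _ i)) ([]=⇒lookup i∈)
... | yes Pi | _ = Pi
... | no  _  | ()

sandwich : ∀ {n} (S T : Subset n) r → S ⊆ T → ∣ S ∣ ≤ r → r ≤ ∣ T ∣ →
           Σ (Subset n) λ H → S ⊆ H × H ⊆ T × ∣ H ∣ ≡ r
sandwich [] [] zero _ _ _ = [] , id , id , refl
sandwich (inside ∷ S) (outside ∷ T) r S⊆T _ _ with S⊆T here
... | ()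
sandwich (inside ∷ S) (inside ∷ T) (suc r) S⊆T (s≤s ∣S∣≤r) (s≤s r≤∣T∣)
  with sandwich S T r (drop-∷-⊆ S⊆T) ∣S∣≤r r≤∣T∣
... | H , S⊆H , H⊆T , ∣H∣≡r = inside ∷ H , s⊆s S⊆H , s⊆s H⊆T , cong suc ∣H∣≡r
sandwich (outside ∷ S) (outside ∷ T) r S⊆T ∣S∣≤r r≤∣T∣
  with sandwich S T r (drop-∷-⊆ S⊆T) ∣S∣≤r r≤∣T∣
... | H , S⊆H , H⊆T , ∣H∣≡r = outside ∷ H , s⊆s S⊆H , s⊆s H⊆T , ∣H∣≡r
sandwich (outside ∷ S) (inside ∷ T) r S⊆T ∣S∣≤r _ with r ≤? ∣ T ∣
... | yes r≤∣T∣ with sandwich S T r (drop-∷-⊆ S⊆T) ∣S∣≤r r≤∣T∣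
...   | H , S⊆H , H⊆T , ∣H∣≡r = outside ∷ H , s⊆s S⊆H , out⊆ H⊆T , ∣H∣≡r
sandwich (outside ∷ S) (inside ∷ T) zero    _ _ _ | no 0≰∣T∣ = contradiction z≤n 0≰∣T∣
sandwich (outside ∷ S) (inside ∷ T) (suc r) S⊆T _ (s≤s r≤∣T∣) | no 1+r≰∣T∣
  with sandwich S T r (drop-∷-⊆ S⊆T) (≤-trans (p⊆q⇒∣p∣≤∣q∣ (drop-∷-⊆ S⊆T)) (≮⇒≥ 1+r≰∣T∣)) r≤∣T∣
... | H , S⊆H , H⊆T , ∣H∣≡r = inside ∷ H , out⊆ S⊆H , s⊆s H⊆T , cong suc ∣H∣≡r

subset-of-size : ∀ {n} (T : Subset n) r → r ≤ ∣ T ∣ → Σ (Subset n) λ H → H ⊆ T × ∣ H ∣ ≡ r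
subset-of-size {n} T r r≤∣T∣ with sandwich ⊥ T r (⊆-min T) (subst (_≤ r) (sym (∣⊥∣≡0 n)) z≤n) r≤∣T∣
... | H , _ , H⊆T , ∣H∣≡r = H , H⊆T , ∣H∣≡r

⁅x⁆⊆∁⁅y⁆ : ∀ {n} {x y : Fin n} → x ≢ y → ⁅ x ⁆ ⊆ ∁ ⁅ y ⁆
⁅x⁆⊆∁⁅y⁆ {x = x} x≢y i∈⁅x⁆ = x∉p⇒x∈∁p (x≢y⇒x∉⁅y⁆ (x≢y ∘ trans (sym (x∈⁅y⁆⇒x≡y x i∈⁅x⁆))))

separating-set : ∀ {n l} (c j : Fin n) → c ≢ j → 1 ≤ l → l ≤ n ∸ 1 →
                 Σ (Subset n) λ C → ∣ C ∣ ≡ l × c ∈ C × j ∉ C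
separating-set {n} {l} c j c≢j 1≤l l≤n-1
  with sandwich ⁅ c ⁆ (∁ ⁅ j ⁆) l (⁅x⁆⊆∁⁅y⁆ c≢j)
         (subst (_≤ l) (sym (∣⁅x⁆∣≡1 c)) 1≤l)
         (subst (l ≤_) (sym (trans (∣∁p∣≡n∸∣p∣ ⁅ j ⁆) (cong (n ∸_) (∣⁅x⁆∣≡1 j)))) l≤n-1)
... | C , ⁅c⁆⊆C , C⊆∁⁅j⁆ , ∣C∣≡l =
  C , ∣C∣≡l , ⁅c⁆⊆C (x∈⁅x⁆ c) , λ j∈C → x∈∁p⇒x∉p (C⊆∁⁅j⁆ j∈C) (x∈⁅x⁆ j)

another : ∀ {n} → 2 ≤ n → (p : Fin n) → ∃ λ j → j ≢ p
another {suc zero}    (s≤s ()) _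
another {suc (suc _)} _        p = punchIn p zero , punchInᵢ≢i p zero

minV≤ : ∀ {n} (x : Pos n) i → minV x ≤ x i
minV≤ {suc zero}    x zero    = ≤-refl
minV≤ {suc (suc n)} x zero    = m⊓n≤m (x zero) _
minV≤ {suc (suc n)} x (suc i) = ≤-trans (m⊓n≤n (x zero) _) (minV≤ (x ∘ suc) i)

minV-attained : ∀ {n} (x : Pos n) → 0 < n → ∃ λ i → x i ≡ minV x
minV-attained {suc zero}    x _ = zero , refl
minV-attained {suc (suc n)} x _ with ⊓-sel (x zero) (minV (x ∘ suc)) | minV-attained (x ∘ suc) (s≤s z≤n)
... | inj₁ min≡x₀ | _        = zero , sym min≡x₀
... | inj₂ min≡m′ | i , xi≡m′ = suc i , trans xi≡m′ (sym min≡m′)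

minV-unique : ∀ {n} (x : Pos n) {μ} (j : Fin n) → (∀ i → μ ≤ x i) → x j ≡ μ → minV x ≡ μ
minV-unique {suc n} x j μ≤x xj≡μ with minV-attained x (s≤s z≤n)
... | p , xp≡m = ≤-antisym (subst (minV x ≤_) xj≡μ (minV≤ x j)) (subst (_ ≤_) xp≡m (μ≤x p))

fill : ∀ {n} → (Fin n → ℕ) → ℕ → Fin n → ℕ
fill c s zero    = c zero ⊓ s
fill c s (suc i) = fill (c ∘ suc) (s ∸ c zero) i

fill≤ : ∀ {n} (c : Fin n → ℕ) s i → fill c s i ≤ c i
fill≤ c s zero    = m⊓n≤m (c zero) s
fill≤ c s (suc i) = fill≤ (c ∘ suc) (s ∸ c zero) i

greedy-step : ∀ a s R → a ⊓ s + (s ∸ a) ⊓ R ≡ s ⊓ (a + R)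
greedy-step a s R with a ≤? s
... | yes a≤s = begin
  a ⊓ s + (s ∸ a) ⊓ R          ≡⟨ cong (_+ (s ∸ a) ⊓ R) (m≤n⇒m⊓n≡m a≤s) ⟩
  a + (s ∸ a) ⊓ R              ≡⟨ +-distribˡ-⊓ a (s ∸ a) R ⟩
  (a + (s ∸ a)) ⊓ (a + R)      ≡⟨ cong (_⊓ (a + R)) (m+[n∸m]≡n a≤s) ⟩
  s ⊓ (a + R)                  ∎
  where open ≡-Reasoning
... | no a≰s = begin
  a ⊓ s + (s ∸ a) ⊓ R          ≡⟨ cong (λ u → a ⊓ s + u ⊓ R) (m≤n⇒m∸n≡0 s≤a) ⟩
  a ⊓ s + 0                    ≡⟨ +-identityʳ (a ⊓ s) ⟩
  a ⊓ s                        ≡⟨ m≥n⇒m⊓n≡n s≤a ⟩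
  s                            ≡⟨ m≤n⇒m⊓n≡m (≤-trans s≤a (m≤m+n a R)) ⟨
  s ⊓ (a + R)                  ∎
  where
  open ≡-Reasoning
  s≤a : s ≤ a
  s≤a = <⇒≤ (≰⇒> a≰s)

sum-fill : ∀ {n} (c : Fin n → ℕ) s → sum (fill c s) ≡ s ⊓ sum c
sum-fill {zero}  c s = sym (⊓-zeroʳ s)
sum-fill {suc n} c s =
  trans (cong (c zero ⊓ s +_) (sum-fill (c ∘ suc) (s ∸ c zero))) (greedy-step (c zero) s _)

-- capacity w t = Σᵢ min(wᵢ, t): the most any t moves can use of w.
capacity : ∀ {n} → Pos n → ℕ → ℕ
capacity w t = sum (λ i → w i ⊓ t)

capacity-cong : ∀ {n} {w w′ : Pos n} → w ≗ w′ → ∀ t → capacity w t ≡ capacity w′ t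
capacity-cong w≗w′ t = sum-cong-≗ (λ i → cong (_⊓ t) (w≗w′ i))

⊓-suc≤ : ∀ v t → v ⊓ suc t ≤ v ⊓ t + 1
⊓-suc≤ zero    t       = z≤n
⊓-suc≤ (suc v) zero    = s≤s (≤-reflexive (⊓-zeroʳ v))
⊓-suc≤ (suc v) (suc t) = s≤s (⊓-suc≤ v t)

⊓-suc-≡ : ∀ {v t} → v ≤ t → v ⊓ suc t ≡ v ⊓ t
⊓-suc-≡ v≤t = trans (m≤n⇒m⊓n≡m (m≤n⇒m≤1+n v≤t)) (sym (m≤n⇒m⊓n≡m v≤t))

⊓-suc-pred : ∀ {v} t → 1 ≤ v → v ⊓ suc t ≤ (v ∸ 1) ⊓ t + 1
⊓-suc-pred {suc v} t _ = ≤-reflexive (+-comm 1 (v ⊓ t))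

EdgesAtLeast : ∀ {n} → Hypergraph n → ℕ → Set
EdgesAtLeast 𝓗 l = ∀ H → 𝓗 H → l ≤ ∣ H ∣

AllOfSize : ∀ {n} → Hypergraph n → ℕ → Set
AllOfSize 𝓗 l = ∀ H → ∣ H ∣ ≡ l → 𝓗 H

module _ {n} (𝓗 : Hypergraph n) (l : ℕ) where

  plays-prefix : ∀ {w s} → Plays 𝓗 w s → ∀ r → r ≤ s → Plays 𝓗 w r
  plays-prefix p              zero    _         = done _
  plays-prefix (step mv p) (suc r) (s≤s r≤s) = step mv (plays-prefix p r r≤s)

  move-capacity : ∀ {w w′ : Pos n} (H : Subset n) t → (∀ i → i ∈ H → w′ i < w i) → (∀ i → i ∉ H → w′ i ≡ w i) →
                  capacity w′ t + ∣ H ∣ ≤ capacity w (suc t)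
  move-capacity {w} {w′} H t lower keep = begin
    capacity w′ t + ∣ H ∣                      ≡⟨ cong (capacity w′ t +_) (sum-indicator H) ⟨
    capacity w′ t + sum (weight 1 H)           ≡⟨ ∑-distrib-+ (λ i → w′ i ⊓ t) (weight 1 H) ⟨
    sum (λ i → w′ i ⊓ t + weight 1 H i)        ≤⟨ sum-mono pointwise ⟩
    capacity w (suc t)                         ∎
    where
    open ≤-Reasoning
    pointwise : ∀ i → w′ i ⊓ t + weight 1 H i ≤ w i ⊓ suc t
    pointwise i with i ∈? H
    ... | yes i∈H = ≤-trans (≤-reflexive (+-comm (w′ i ⊓ t) 1)) (⊓-monoˡ-≤ (suc t) (lower i i∈H))
    ... | no  i∉H = ≤-trans (≤-reflexive (trans (+-identityʳ _) (cong (_⊓ t) (keep i i∉H))))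
                            (⊓-monoʳ-≤ (w i) (n≤1+n t))

  -- Upper bound: every move costs at least l units of capacity.
  plays⇒capacity : EdgesAtLeast 𝓗 l → ∀ {w} t → Plays 𝓗 w t → l * t ≤ capacity w t
  plays⇒capacity _        zero    _ = ≤-trans (≤-reflexive (*-zeroʳ l)) z≤n
  plays⇒capacity edges≥l {w} (suc t) (step {x' = w′} (H , H∈𝓗 , lower , keep) p) = begin
    l * suc t                  ≡⟨ *-suc l t ⟩
    l + l * t                  ≡⟨ +-comm l (l * t) ⟩
    l * t + l                  ≤⟨ +-mono-≤ (plays⇒capacity edges≥l t p) (edges≥l H H∈𝓗) ⟩
    capacity w′ t + ∣ H ∣      ≤⟨ move-capacity H t lower keep ⟩
    capacity w (suc t)         ∎
    where open ≤-Reasoning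

  tall : Pos n → ℕ → Subset n
  tall w t = ⟦ (λ i → suc t ≤? w i) ⟧

  tall-height : ∀ (w : Pos n) t {i} → i ∈ tall w t → suc t ≤ w i
  tall-height w t = ∈⟦⟧⁻ (λ i → suc t ≤? w i)

  support : Pos n → Subset n
  support w = tall w 0

  tall⊆support : ∀ (w : Pos n) t → tall w t ⊆ support w
  tall⊆support w t i∈ = ∈⟦⟧⁺ (λ i → 1 ≤? w i) (≤-trans (s≤s z≤n) (tall-height w t i∈))

  capacity≤support : ∀ (w : Pos n) t → capacity w t ≤ t * ∣ support w ∣
  capacity≤support w t = ≤-trans (sum-mono pointwise) (≤-reflexive (sum-weight t (support w)))
    where
    pointwise : ∀ i → w i ⊓ t ≤ weight t (support w) i
    pointwise i with i ∈? support w
    ... | yes _  = m⊓n≤n (w i) t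
    ... | no  i∉ = ≤-trans (m⊓n≤m (w i) t) (≮⇒≥ (i∉ ∘ ∈⟦⟧⁺ (λ i → 1 ≤? w i)))

  choose-edge : ∀ (w : Pos n) t → l ≤ ∣ support w ∣ →
    Σ (Subset n) λ H → ∣ H ∣ ≡ l × H ⊆ support w × (tall w t ⊆ H ⊎ H ⊆ tall w t)
  choose-edge w t l≤∣supp∣ with ∣ tall w t ∣ ≤? l
  ... | yes few with sandwich (tall w t) (support w) l (tall⊆support w t) few l≤∣supp∣
  ...   | H , tall⊆H , H⊆supp , ∣H∣≡l = H , ∣H∣≡l , H⊆supp , inj₁ tall⊆H
  choose-edge w t l≤∣supp∣ | no many with subset-of-size (tall w t) l (<⇒≤ (≰⇒> many))
  ...   | H , H⊆tall , ∣H∣≡l = H , ∣H∣≡l , tall⊆support w t ∘ H⊆tall , inj₂ H⊆tall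

  decrement : Subset n → Pos n → Pos n
  decrement H w i = w i ∸ weight 1 H i

  decrement-lowers : ∀ {w} (H : Subset n) → H ⊆ support w → ∀ i → i ∈ H → decrement H w i < w i
  decrement-lowers {w} H H⊆supp i i∈H with i ∈? H
  ... | yes _   = ∸-monoʳ-< {w i} (s≤s z≤n) (tall-height w 0 (H⊆supp i∈H))
  ... | no i∉H = contradiction i∈H i∉H

  decrement-keeps : ∀ {w} (H : Subset n) i → i ∉ H → decrement H w i ≡ w i
  decrement-keeps H i i∉H with i ∈? H
  ... | yes i∈H = contradiction i∈H i∉H
  ... | no  _   = refl

  decrement-capacity : ∀ (w : Pos n) t → l * suc t ≤ capacity w (suc t) → (H : Subset n) →
    ∣ H ∣ ≡ l → H ⊆ support w → (tall w t ⊆ H ⊎ H ⊆ tall w t) →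
    l * t ≤ capacity (decrement H w) t
  decrement-capacity w t enough H ∣H∣≡l H⊆supp (inj₁ tall⊆H) =
    +-cancelʳ-≤ l (l * t) _ (begin
      l * t + l                                        ≡⟨ trans (+-comm (l * t) l) (sym (*-suc l t)) ⟩
      l * suc t                                        ≤⟨ enough ⟩
      capacity w (suc t)                               ≤⟨ sum-mono pointwise ⟩
      sum (λ i → decrement H w i ⊓ t + weight 1 H i)   ≡⟨ ∑-distrib-+ (λ i → decrement H w i ⊓ t) _ ⟩
      capacity (decrement H w) t + sum (weight 1 H)    ≡⟨ cong (capacity (decrement H w) t +_)
                                                             (trans (sum-indicator H) ∣H∣≡l) ⟩
      capacity (decrement H w) t + l                   ∎)
    where
    open ≤-Reasoning
    -- untouched coordinates are not tall, so they lose nothing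
    pointwise : ∀ i → w i ⊓ suc t ≤ decrement H w i ⊓ t + weight 1 H i
    pointwise i with i ∈? H
    ... | yes i∈H = ⊓-suc-pred t (tall-height w 0 (H⊆supp i∈H))
    ... | no  i∉H = ≤-reflexive (trans (⊓-suc-≡ wi≤t) (sym (+-identityʳ _)))
      where
      wi≤t : w i ≤ t
      wi≤t = ≮⇒≥ (λ t<wi → i∉H (tall⊆H (∈⟦⟧⁺ (λ i → suc t ≤? w i) t<wi)))
  decrement-capacity w t _ H ∣H∣≡l _ (inj₂ H⊆tall) = begin
    l * t                                  ≡⟨ *-comm l t ⟩
    t * l                                  ≤⟨ *-monoʳ-≤ t (subst (_≤ _) ∣H∣≡l (p⊆q⇒∣p∣≤∣q∣ H⊆tall)) ⟩
    t * ∣ tall w t ∣                       ≡⟨ sum-weight t (tall w t) ⟨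
    sum (weight t (tall w t))              ≤⟨ sum-mono pointwise ⟩
    capacity (decrement H w) t             ∎
    where
    open ≤-Reasoning
    -- tall coordinates stay at height ≥ t after losing at most one unit
    pointwise : ∀ i → weight t (tall w t) i ≤ decrement H w i ⊓ t
    pointwise i with i ∈? tall w t
    ... | no  _   = z≤n
    ... | yes i∈ = ≤-reflexive (sym (m≥n⇒m⊓n≡n (≤-trans (∸-monoˡ-≤ 1 (tall-height w t i∈))
                                                          (∸-monoʳ-≤ (w i) weight≤1))))
      where
      weight≤1 : weight 1 H i ≤ 1
      weight≤1 with i ∈? H
      ... | yes _ = ≤-refl
      ... | no  _ = z≤n

  capacity⇒plays : AllOfSize 𝓗 l → ∀ t w → l * t ≤ capacity w t → Plays 𝓗 w t
  capacity⇒plays _      zero    w _      = done w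
  capacity⇒plays l-sets (suc t) w enough with choose-edge w t l≤∣supp∣
    where
    l≤∣supp∣ : l ≤ ∣ support w ∣
    l≤∣supp∣ = *-cancelʳ-≤ l _ (suc t)
      (≤-trans enough (≤-trans (capacity≤support w (suc t)) (≤-reflexive (*-comm (suc t) _))))
  ... | H , ∣H∣≡l , H⊆supp , shape =
    step (H , l-sets H ∣H∣≡l , decrement-lowers H H⊆supp , decrement-keeps H)
         (capacity⇒plays l-sets t (decrement H w) (decrement-capacity w t enough H ∣H∣≡l H⊆supp shape))

  tetris-by-capacity : EdgesAtLeast 𝓗 l → AllOfSize 𝓗 l → ∀ {w} t →
    l * t ≤ capacity w t → capacity w (suc t) < l * suc t → Tetris 𝓗 w t
  tetris-by-capacity edges≥l l-sets {w} t enough short = capacity⇒plays l-sets t w enough , maximal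
    where
    maximal : ∀ s → Plays 𝓗 w s → s ≤ t
    maximal s p with s ≤? t
    ... | yes s≤t = s≤t
    ... | no  s≰t = contradiction (plays⇒capacity edges≥l (suc t) (plays-prefix p (suc t) (≰⇒> s≰t)))
                                  (<⇒≱ short)

module _ {n} (𝓗 : Hypergraph n) (l : ℕ) (edges≥l : EdgesAtLeast 𝓗 l) (l-sets : AllOfSize 𝓗 l)
         (co-l-sets : ∀ C → ∣ C ∣ ≡ l → 𝓗 (∁ C)) where

  -- The move x → x′ along ∁ C towards minimum μ and Tetris value t of the
  -- shifted position: C keeps its values, j drops to μ, the other coordinates
  -- are lowered and filled greedily.
  module Construction (x : Pos n) (μ : ℕ) (μ<m : μ < minV x) (t : ℕ)
                      (C : Subset n) (∣C∣≡l : ∣ C ∣ ≡ l) (j : Fin n) (j∉C : j ∉ C) where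

    v : Pos n
    v i = x i ∸ μ

    x≡v+μ : ∀ i → x i ≡ v i + μ
    x≡v+μ i = sym (m∸n+n≡m (≤-trans (<⇒≤ μ<m) (minV≤ x i)))

    1≤v : ∀ i → 1 ≤ v i
    1≤v i = m<n⇒0<n∸m (≤-trans μ<m (minV≤ x i))

    kept : Pos n
    kept i = if does (i ∈? C) then v i else 0

    room : Pos n
    room i = if does (i ∈? C) then 0 else if does (i ≟ᶠ j) then 0 else (v i ∸ 1) ⊓ t

    kept-∈ : ∀ {i} → i ∈ C → kept i ≡ v i
    kept-∈ {i} = if-yes (i ∈? C)

    kept-∉ : ∀ {i} → i ∉ C → kept i ≡ 0
    kept-∉ {i} = if-no (i ∈? C)

    room-∈ : ∀ {i} → i ∈ C → room i ≡ 0
    room-∈ {i} = if-yes (i ∈? C)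

    room-j : room j ≡ 0
    room-j = trans (if-no (j ∈? C) j∉C) (if-yes (j ≟ᶠ j) refl)

    room-other : ∀ {i} → i ∉ C → i ≢ j → room i ≡ (v i ∸ 1) ⊓ t
    room-other {i} i∉C i≢j = trans (if-no (i ∈? C) i∉C) (if-no (i ≟ᶠ j) i≢j)

    room≤t : ∀ i → room i ≤ t
    room≤t i with i ∈? C | i ≟ᶠ j
    ... | yes _ | _     = z≤n
    ... | no  _ | yes _ = z≤n
    ... | no  _ | no  _ = m⊓n≤n _ t

    room<v : ∀ {i} → i ∉ C → room i < v i
    room<v {i} i∉C = case i ≟ᶠ j of λ where
      (yes refl) → subst (_< v j) (sym room-j) (1≤v j)
      (no i≢j)   → subst (_< v i) (sym (room-other i∉C i≢j))
        (≤-trans (s≤s (m⊓n≤m (v i ∸ 1) t)) (≤-reflexive (trans (+-comm 1 (v i ∸ 1)) (m∸n+n≡m (1≤v i)))))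

    -- the most capacity at horizon t the new position can be given
    budget : Fin n → ℕ
    budget i = kept i ⊓ t + room i

    budget-∈ : ∀ {i} → i ∈ C → budget i ≡ v i ⊓ t
    budget-∈ i∈C = trans (cong₂ _+_ (cong (_⊓ t) (kept-∈ i∈C)) (room-∈ i∈C)) (+-identityʳ _)

    budget-other : ∀ {i} → i ∉ C → i ≢ j → budget i ≡ (v i ∸ 1) ⊓ t
    budget-other i∉C i≢j = cong₂ _+_ (cong (_⊓ t) (kept-∉ i∉C)) (room-other i∉C i≢j)

    spare : Pos n
    spare = fill room (l * t ∸ sum (λ i → kept i ⊓ t))

    w : Pos n
    w i = kept i + spare i

    x′ : Pos n
    x′ i = w i + μ

    spare≤t : ∀ i → spare i ≤ t
    spare≤t i = ≤-trans (fill≤ room _ i) (room≤t i)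

    spare-∈ : ∀ {i} → i ∈ C → spare i ≡ 0
    spare-∈ {i} i∈C = n≤0⇒n≡0 (subst (spare i ≤_) (room-∈ i∈C) (fill≤ room _ i))

    spare-j : spare j ≡ 0
    spare-j = n≤0⇒n≡0 (subst (spare j ≤_) room-j (fill≤ room _ j))

    w-∈ : ∀ {i} → i ∈ C → w i ≡ v i
    w-∈ i∈C = trans (cong₂ _+_ (kept-∈ i∈C) (spare-∈ i∈C)) (+-identityʳ _)

    w-∉ : ∀ {i} → i ∉ C → w i ≡ spare i
    w-∉ {i} i∉C = cong (_+ spare i) (kept-∉ i∉C)

    move : Move 𝓗 x x′
    move = ∁ C , co-l-sets C ∣C∣≡l , lower , keep
      where
      lower : ∀ i → i ∈ ∁ C → x′ i < x i
      lower i i∈∁C = subst (x′ i <_) (sym (x≡v+μ i)) (+-monoˡ-< μ (begin-strict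
        w i       ≡⟨ w-∉ i∉C ⟩
        spare i   ≤⟨ fill≤ room _ i ⟩
        room i    <⟨ room<v i∉C ⟩
        v i       ∎))
        where
        open ≤-Reasoning
        i∉C : i ∉ C
        i∉C = x∈∁p⇒x∉p i∈∁C
      keep : ∀ i → i ∉ ∁ C → x′ i ≡ x i
      keep i i∉∁C = trans (cong (_+ μ) (w-∈ (x∉∁p⇒x∈p i∉∁C))) (sym (x≡v+μ i))

    minV-x′ : minV x′ ≡ μ
    minV-x′ = minV-unique x′ j (λ i → m≤n+m μ (w i)) (cong (_+ μ) (trans (w-∉ j∉C) spare-j))

    shift-x′ : shift x′ ≗ w
    shift-x′ i = trans (cong (x′ i ∸_) minV-x′) (m+n∸n≡m (w i) μ)

    kept-capacity : sum (λ i → kept i ⊓ t) ≤ l * t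
    kept-capacity = ≤-trans (sum-mono pointwise)
      (≤-reflexive (trans (sum-weight t C) (trans (cong (t *_) ∣C∣≡l) (*-comm t l))))
      where
      pointwise : ∀ i → kept i ⊓ t ≤ weight t C i
      pointwise i with i ∈? C
      ... | yes _ = m⊓n≤n (v i) t
      ... | no  _ = z≤n

    capacity-w : l * t ≤ sum budget → capacity w t ≡ l * t
    capacity-w enough = begin
      capacity w t                        ≡⟨ sum-cong-≗ pointwise ⟩
      sum (λ i → kept i ⊓ t + spare i)    ≡⟨ ∑-distrib-+ (λ i → kept i ⊓ t) spare ⟩
      K + sum spare                       ≡⟨ cong (K +_) (sum-fill room (l * t ∸ K)) ⟩
      K + (l * t ∸ K) ⊓ sum room          ≡⟨ cong (K +_) (m≤n⇒m⊓n≡m fits) ⟩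
      K + (l * t ∸ K)                     ≡⟨ m+[n∸m]≡n kept-capacity ⟩
      l * t                               ∎
      where
      open ≡-Reasoning
      K = sum (λ i → kept i ⊓ t)
      fits : l * t ∸ K ≤ sum room
      fits = subst (l * t ∸ K ≤_) (m+n∸m≡n K (sum room))
               (∸-monoˡ-≤ K (subst (l * t ≤_) (∑-distrib-+ (λ i → kept i ⊓ t) room) enough))
      -- on C nothing is added, outside C the filling is below the horizon
      pointwise : ∀ i → w i ⊓ t ≡ kept i ⊓ t + spare i
      pointwise i with i ∈? C
      ... | yes i∈C = trans (cong (λ u → (v i + u) ⊓ t) (spare-∈ i∈C))
                        (trans (cong (_⊓ t) (+-identityʳ (v i)))
                          (sym (trans (cong (v i ⊓ t +_) (spare-∈ i∈C)) (+-identityʳ _))))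
      ... | no  _   = m≤n⇒m⊓n≡m (spare≤t i)

    capacity-w-suc : (c : Fin n) → c ∈ C → v c ≤ t → l * t ≤ sum budget →
                     capacity w (suc t) < l * suc t
    capacity-w-suc c c∈C vc≤t enough = begin-strict
      capacity w (suc t)                      <⟨ sum-mono-< pointwise c at-c ⟩
      sum (λ i → w i ⊓ t + weight 1 C i)      ≡⟨ ∑-distrib-+ (λ i → w i ⊓ t) (weight 1 C) ⟩
      capacity w t + sum (weight 1 C)         ≡⟨ cong₂ _+_ (capacity-w enough) (trans (sum-indicator C) ∣C∣≡l) ⟩
      l * t + l                               ≡⟨ +-comm (l * t) l ⟩
      l + l * t                               ≡⟨ *-suc l t ⟨
      l * suc t                               ∎
      where
      open ≤-Reasoning
      pointwise : ∀ i → w i ⊓ suc t ≤ w i ⊓ t + weight 1 C i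
      pointwise i with i ∈? C
      ... | yes _ = ⊓-suc≤ _ t
      ... | no  _ = ≤-reflexive (trans (⊓-suc-≡ (spare≤t i)) (sym (+-identityʳ _)))
      at-c : w c ⊓ suc t < w c ⊓ t + weight 1 C c
      at-c = subst (λ u → w c ⊓ suc t < w c ⊓ t + u) (sym (if-yes (c ∈? C) c∈C))
        (≤-reflexive (trans (cong suc (⊓-suc-≡ (subst (_≤ t) (sym (w-∈ c∈C)) vc≤t))) (+-comm 1 _)))

    budget-covers-shift : x j ≡ minV x → ∀ i → shift x i ⊓ t ≤ budget i
    budget-covers-shift xj≡m i = case ((i ∈? C) , (i ≟ᶠ j)) of λ where
      (yes i∈C , _)       → subst (shift x i ⊓ t ≤_) (sym (budget-∈ i∈C))
                               (⊓-monoˡ-≤ t (∸-monoʳ-≤ (x i) (<⇒≤ μ<m)))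
      (no  _   , yes refl) → subst (λ u → u ⊓ t ≤ budget j)
                               (sym (trans (cong (_∸ minV x) xj≡m) (n∸n≡0 (minV x)))) z≤n
      (no  i∉C , no i≢j)  → subst (shift x i ⊓ t ≤_) (sym (budget-other i∉C i≢j))
                               (⊓-monoˡ-≤ t (∸-monoˡ-≤ 1 (∸-monoʳ-< μ<m (minV≤ x i))))

    budget-from-shift : x j ≡ minV x → l * t ≤ capacity (shift x) t → l * t ≤ sum budget
    budget-from-shift xj≡m shifted = ≤-trans shifted (sum-mono (budget-covers-shift xj≡m))

    budget-covers-all-but-two : (p : Fin n) → (∀ i → i ≢ p → t < v i) →
      ∀ i → t ≤ budget i + (weight t ⁅ p ⁆ i + weight t ⁅ j ⁆ i)
    budget-covers-all-but-two p high i with i ∈? ⁅ p ⁆ | i ∈? ⁅ j ⁆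
    ... | yes _    | _        = ≤-trans (m≤m+n t _) (m≤n+m _ (budget i))
    ... | no  _    | yes _    = m≤n+m t (budget i)
    ... | no i∉⁅p⁆ | no i∉⁅j⁆ = ≤-trans t≤budget (m≤m+n (budget i) 0)
      where
      t<vi : t < v i
      t<vi = high i (i∉⁅p⁆ ∘ λ i≡p → subst (_∈ ⁅ p ⁆) (sym i≡p) (x∈⁅x⁆ p))
      t≤budget : t ≤ budget i
      t≤budget = case i ∈? C of λ where
        (yes i∈C) → subst (t ≤_) (sym (budget-∈ i∈C)) (≤-reflexive (sym (m≥n⇒m⊓n≡n (<⇒≤ t<vi))))
        (no  i∉C) → subst (t ≤_) (sym (budget-other i∉C (x∉⁅y⁆⇒x≢y i∉⁅j⁆)))
                       (≤-reflexive (sym (m≥n⇒m⊓n≡n (∸-monoˡ-≤ 1 t<vi))))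

    -- with n ≥ l + 2 the n - 2 coordinates other than p and j give enough budget
    budget-when-high : (p : Fin n) → (∀ i → i ≢ p → t < v i) → l + 2 ≤ n → l * t ≤ sum budget
    budget-when-high p high l+2≤n = +-cancelʳ-≤ (t + t) (l * t) (sum budget) (begin
      l * t + (t + t)                    ≡⟨ cong (λ u → l * t + (t + u)) (+-identityʳ t) ⟨
      l * t + 2 * t                      ≡⟨ *-distribʳ-+ t l 2 ⟨
      (l + 2) * t                        ≤⟨ *-monoˡ-≤ t l+2≤n ⟩
      n * t                              ≡⟨ sum-const n t ⟨
      sum {n} (λ _ → t)                  ≤⟨ sum-mono (budget-covers-all-but-two p high) ⟩
      sum (λ i → budget i + (weight t ⁅ p ⁆ i + weight t ⁅ j ⁆ i))
                                         ≡⟨ ∑-distrib-+ budget _ ⟩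
      sum budget + sum (λ i → weight t ⁅ p ⁆ i + weight t ⁅ j ⁆ i)
                                         ≡⟨ cong (sum budget +_) (∑-distrib-+ (weight t ⁅ p ⁆) _) ⟩
      sum budget + (sum (weight t ⁅ p ⁆) + sum (weight t ⁅ j ⁆))
                                         ≡⟨ cong (sum budget +_) (cong₂ _+_ (sum-point-mass t p) (sum-point-mass t j)) ⟩
      sum budget + (t + t)               ∎)
      where open ≤-Reasoning

    realised : (c : Fin n) → c ∈ C → v c ≤ t → l * t ≤ sum budget →
               Σ (Pos n) λ y → Move 𝓗 x y × (minV y ≡ μ × Y 𝓗 y (suc t))
    realised c c∈C vc≤t enough = x′ , move , minV-x′ , t , tetris , refl
      where
      tetris : Tetris 𝓗 (shift x′) t
      tetris = tetris-by-capacity 𝓗 l edges≥l l-sets t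
        (≤-reflexive (sym (trans (capacity-cong shift-x′ t) (capacity-w enough))))
        (subst (_< l * suc t) (sym (capacity-cong shift-x′ (suc t)))
          (capacity-w-suc c c∈C vc≤t enough))

  every-value-reachable : 1 ≤ l → l + 2 ≤ n →
    (x : Pos n) (μ η y : ℕ) → Y 𝓗 x y → μ < minV x → minV x ∸ μ + 1 ≤ η → η ≤ y →
    Σ (Pos n) λ x′ → Move 𝓗 x x′ × (minV x′ ≡ μ × Y 𝓗 x′ η)
  every-value-reachable _ _ x μ zero _ _ _ d+1≤0 _ = contradiction (≤-trans (m≤n+m 1 _) d+1≤0) λ ()
  every-value-reachable 1≤l l+2≤n x μ (suc t) _ (t₀ , (plays , _) , refl) μ<m d+1≤η η≤y =
    by-cases (any? (λ q → ¬? (q ≟ᶠ p) ×-dec (x q ∸ μ ≤? t)))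
    where
    Goal : Set
    Goal = Σ (Pos n) λ x′ → Move 𝓗 x x′ × (minV x′ ≡ μ × Y 𝓗 x′ (suc t))

    2≤n : 2 ≤ n
    2≤n = ≤-trans (m≤n+m 2 l) l+2≤n

    l≤n-1 : l ≤ n ∸ 1
    l≤n-1 = subst (_≤ n ∸ 1) (m+n∸n≡m l 1) (∸-monoˡ-≤ 1 (≤-trans (+-monoʳ-≤ l (s≤s z≤n)) l+2≤n))

    minimiser : ∃ λ p → x p ≡ minV x
    minimiser = minV-attained x (≤-trans (s≤s z≤n) 2≤n)

    p : Fin n
    p = proj₁ minimiser

    xp≡m : x p ≡ minV x
    xp≡m = proj₂ minimiser

    shifted-capacity : l * t ≤ capacity (shift x) t
    shifted-capacity = plays⇒capacity 𝓗 l edges≥l t (plays-prefix 𝓗 l plays t (≤-pred η≤y))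

    vp≤t : x p ∸ μ ≤ t
    vp≤t = subst (λ u → u ∸ μ ≤ t) (sym xp≡m) (≤-pred (subst (_≤ suc t) (+-comm (minV x ∸ μ) 1) d+1≤η))

    -- some q ≠ p is at height ≤ t: keep q, drop p
    via-low : (q : Fin n) → q ≢ p → x q ∸ μ ≤ t → Goal
    via-low q q≢p vq≤t with separating-set q p q≢p 1≤l l≤n-1
    ... | C , ∣C∣≡l , q∈C , p∉C =
      realised q q∈C vq≤t (budget-from-shift xp≡m shifted-capacity)
      where open Construction x μ μ<m t C ∣C∣≡l p p∉C

    -- every q ≠ p is above t: keep p, drop some other j
    via-high : (∀ i → i ≢ p → t < x i ∸ μ) → Goal
    via-high high with another 2≤n p
    ... | j , j≢p with separating-set p j (j≢p ∘ sym) 1≤l l≤n-1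
    ...   | C , ∣C∣≡l , p∈C , j∉C = realised p p∈C vp≤t (budget-when-high p high l+2≤n)
      where open Construction x μ μ<m t C ∣C∣≡l j j∉C

    by-cases : Dec (∃ λ q → q ≢ p × x q ∸ μ ≤ t) → Goal
    by-cases (yes (q , q≢p , vq≤t)) = via-low q q≢p vq≤t
    by-cases (no none) = via-high (λ i i≢p → ≰⇒> (λ vi≤t → none (i , i≢p , vi≤t)))

-- The union of levels satisfies the hypotheses of every-value-reachable with
-- l = λ₁: λ₁ is the least level, complements of λ₁-sets have λ_k elements,
-- and n = λ₁ + λ_k ≥ λ₁ + 2.
lemma7 : (n k : ℕ) (lam : Fin (suc k) → ℕ) →
    (∀ i j → i <ᶠ j → lam i < lam j) →
    0 < lam zero →
    lam (fromℕ k) ≤ n →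
    1 < lam zero →
    (∀ (i : Fin k) → lam (suc i) ∸ lam (inject₁ i) ≤ lam zero) →
    lam zero + lam (fromℕ k) ≡ n →
    (x : Pos n) (μ η y : ℕ) →
    Y (UnionOfLevels n (suc k) lam) x y →
    μ < minV x →
    minV x ∸ μ + 1 ≤ η →
    η ≤ y →
    Σ (Pos n) λ x' →
    Move (UnionOfLevels n (suc k) lam) x x' × (minV x' ≡ μ × Y (UnionOfLevels n (suc k) lam) x' η)
lemma7 n k lam increasing _ _ 1<l _ l+L≡n =
  every-value-reachable 𝓗 l edges≥l l-sets co-l-sets (<⇒≤ 1<l) l+2≤n
  where
  𝓗 = UnionOfLevels n (suc k) lam
  l = lam zero
  L = lam (fromℕ k)

  l-least : ∀ i → l ≤ lam i
  l-least zero    = ≤-refl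
  l-least (suc i) = <⇒≤ (increasing zero (suc i) (s≤s z≤n))

  edges≥l : EdgesAtLeast 𝓗 l
  edges≥l H (i , ∣H∣≡λᵢ) = subst (l ≤_) (sym ∣H∣≡λᵢ) (l-least i)

  l-sets : AllOfSize 𝓗 l
  l-sets H ∣H∣≡l = zero , ∣H∣≡l

  co-l-sets : ∀ C → ∣ C ∣ ≡ l → 𝓗 (∁ C)
  co-l-sets C ∣C∣≡l = fromℕ k , (begin
    ∣ ∁ C ∣        ≡⟨ ∣∁p∣≡n∸∣p∣ C ⟩
    n ∸ ∣ C ∣      ≡⟨ cong₂ _∸_ (sym l+L≡n) ∣C∣≡l ⟩
    l + L ∸ l      ≡⟨ m+n∸m≡n l L ⟩
    L              ∎)
    where open ≡-Reasoning

  l+2≤n : l + 2 ≤ n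
  l+2≤n = subst (l + 2 ≤_) l+L≡n (+-monoʳ-≤ l (≤-trans 1<l (l-least (fromℕ k))))
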